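{- There are infinitely many pairs $(x,y)$ of binary words such that $J_{\mathrm{hex}}(xy)<J_{\mathrm{hex}}(x)$ (i.e. infinitely many counterexamples to the statement "$J_{\mathrm{hex}}(x)\le J_{\mathrm{hex}}(xy)$ for all binary words $x,y$").
   Context: Words are finite strings over $\{0,1\}$ ($0$ = hydrophobic, $1$ = polar); $xy$ is concatenation. The hexagonal lattice is the (3-regular) graph of vertices and edges of the regular hexagonal (honeycomb) tiling of the plane. A fold of a word $w=w_1\cdots w_n$ is a self-avoiding walk $v_1,\dots,v_n$ in this lattice (distinct vertices, $v_i$ adjacent to $v_{i+1}$); its score is the number of pairs $\{i,j\}$ with $|i-j|\ge 2$, $w_i=w_j=0$ and $v_i,v_j$ adjacent. $J_{\mathrm{hex}}(w)$ is the maximum score over all folds of $w$. -}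

module Defs where

open import Data.Bool using (Bool; true; false; _∧_; _∨_; if_then_else_)
open import Data.Nat using (ℕ; zero; suc; _≤_; _<_; _≤ᵇ_)
open import Data.Nat.Divisibility using (_∣?_)
open import Data.Integer using (ℤ; +_; _+_; ∣_∣)
import Data.Integer as ℤ
open import Data.Fin using (Fin; toℕ)
open import Data.List using (List; []; _∷_; length; lookup; map; allFin)
open import Data.Nat.ListAction using (sum)
open import Data.Product using (_×_; _,_; Σ)
open import Relation.Binary.PropositionalEquality using (_≡_)
open import Relation.Nullary.Decidable using (⌊_⌋)

-- Letters: 𝟘 = hydrophobic (0), 𝟙 = polar (1)
data Bit : Set where
  𝟘 𝟙 : Bit

Word : Set
Word = List Bit

isZero : Bit → Bool
isZero 𝟘 = true
isZero 𝟙 = false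

-- Hexagonal (honeycomb) lattice in "brick-wall" coordinates:
-- vertices ℤ × ℤ; (a , b) is adjacent to (a ± 1 , b), and to (a , b + 1)
-- when a + b is even, resp. to (a , b - 1) when a + b is odd.
-- Every vertex has degree 3 and this graph is isomorphic to the honeycomb graph.
Point : Set
Point = ℤ × ℤ

_==_ : ℤ → ℤ → Bool
x == y = ⌊ x ℤ.≟ y ⌋

evenℤ : ℤ → Bool
evenℤ z = ⌊ 2 ∣? ∣ z ∣ ⌋

adjacent : Point → Point → Bool
adjacent (a , b) (c , d) =
  ((b == d) ∧ ((c == (a + + 1)) ∨ (a == (c + + 1))))
  ∨ ((a == c) ∧ (((d == (b + + 1)) ∧ evenℤ (a + b))
                 ∨ ((b == (d + + 1)) ∧ evenℤ (c + d))))

Adjacent : Point → Point → Set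
Adjacent p q = adjacent p q ≡ true

record Fold (w : Word) : Set where
  field
    pos  : Fin (length w) → Point
    self-avoiding : ∀ i j → pos i ≡ pos j → i ≡ j
    walk : ∀ i j → toℕ j ≡ suc (toℕ i) → Adjacent (pos i) (pos j)
open Fold public

-- indicator of the pair (i , j) contributing to the score (counted once: i + 2 ≤ j)
contact : (w : Word) → Fold w → Fin (length w) → Fin (length w) → ℕ
contact w f i j =
  if (suc (suc (toℕ i)) ≤ᵇ toℕ j) ∧ isZero (lookup w i) ∧ isZero (lookup w j)
     ∧ adjacent (pos f i) (pos f j)
  then 1 else 0

score : (w : Word) → Fold w → ℕ
score w f = sum (map (λ i → sum (map (λ j → contact w f i j) (allFin (length w))))
                     (allFin (length w)))

IsJhex : Word → ℕ → Set
IsJhex w m = Σ (Fold w) (λ f → score w f ≡ m) × (∀ (f : Fold w) → score w f ≤ m)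

-- The hexagonal lattice is bipartite (colour a point (a , b) by the parity of a + b) and
-- 3-regular. Let x = 0 1³ 0 1⁴ 0, whose hydrophobic letters sit at positions 0, 4 and 9.
-- Along any fold, positions 0 and 4 are an even number of steps apart, hence have the same
-- colour and never touch; so J(x) ≤ 2, and a fold in which 9 touches both 0 and 4 gives
-- J(x) = 2. Appending polar letters y = 1^(m+1) creates no new possible contacts, but now
-- position 9 is flanked by 8 and 10 along the walk, leaving it a single free neighbour: it
-- touches at most one of 0 and 4, so J(xy) = 1 < J(x).
module Submission where

open import Defs
open import Data.Bool using (Bool; true; false; not; T; _∧_; _∨_; if_then_else_)
open import Data.Bool.Properties
  using (not-involutive; not-¬; ∧-conicalˡ; ∧-conicalʳ; ∧-zeroʳ; ∨-comm; T-≡)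
open import Data.Empty using (⊥; ⊥-elim)
open import Data.Fin using (Fin; zero; suc; toℕ; fromℕ<; #_)
open import Data.Fin.Properties using (pigeonhole; <⇒≢; toℕ-injective; toℕ<n; toℕ-fromℕ<; all?)
open import Data.Integer as ℤ using (+_; -[1+_])
import Data.Integer.Properties as ℤ
open import Algebra.Properties.CommutativeSemigroup ℤ.+-commutativeSemigroup using (xy∙z≈xz∙y)
open import Data.List using ([]; _∷_; length; lookup; tabulate; _++_; replicate)
open import Data.List.Properties using (map-tabulate; tabulate-cong; length-replicate)
open import Data.Nat using (ℕ; zero; suc; _+_; _*_; _∸_; _%_; _≤_; _<_; z≤n; s≤s; _≤ᵇ_)
import Data.Nat as ℕ
import Data.Nat.Properties as ℕ
open import Data.Nat.Divisibility using (_∣?_)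
open import Data.Nat.ListAction using (sum)
open import Data.Product using (Σ; _×_; _,_; proj₁; proj₂)
open import Data.Sum using (_⊎_; inj₁; inj₂)
open import Function using (_∘_)
open import Function.Bundles using (Equivalence)
open import Function.Definitions using (Injective)
open import Relation.Binary.PropositionalEquality
open import Relation.Nullary using (¬_)
open import Relation.Nullary.Decidable using (⌊_⌋; yes; no; toWitness; fromWitness; from-yes; ⌊⌋-map′)

%2-suc : ∀ n → ⌊ suc n % 2 ℕ.≟ 0 ⌋ ≡ not ⌊ n % 2 ℕ.≟ 0 ⌋
%2-suc zero          = refl
%2-suc (suc zero)    = refl
%2-suc (suc (suc n)) = %2-suc n

⌊2∣?suc⌋ : ∀ n → ⌊ 2 ∣? suc n ⌋ ≡ not ⌊ 2 ∣? n ⌋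
⌊2∣?suc⌋ n = trans (⌊⌋-map′ _ _ _) (trans (%2-suc n) (cong not (sym (⌊⌋-map′ _ _ _))))

evenℤ-suc : ∀ z → evenℤ (z ℤ.+ + 1) ≡ not (evenℤ z)
evenℤ-suc (+ n)          = trans (cong (λ k → ⌊ 2 ∣? k ⌋) (ℕ.+-comm n 1)) (⌊2∣?suc⌋ n)
evenℤ-suc -[1+ zero ]    = refl
evenℤ-suc -[1+ suc n ]   = trans (sym (not-involutive _)) (cong not (sym (⌊2∣?suc⌋ (suc n))))

evenℤ-+suc : ∀ a b → evenℤ (a ℤ.+ (b ℤ.+ + 1)) ≡ not (evenℤ (a ℤ.+ b))
evenℤ-+suc a b = trans (cong evenℤ (sym (ℤ.+-assoc a b (+ 1)))) (evenℤ-suc (a ℤ.+ b))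

z+1-1≡z : ∀ z → (z ℤ.+ + 1) ℤ.- + 1 ≡ z
z+1-1≡z z = trans (ℤ.+-assoc z (+ 1) (ℤ.- + 1)) (ℤ.+-identityʳ z)

z-1+1≡z : ∀ z → (z ℤ.- + 1) ℤ.+ + 1 ≡ z
z-1+1≡z z = trans (ℤ.+-assoc z (ℤ.- + 1) (+ 1)) (ℤ.+-identityʳ z)

evenℤ-pred : ∀ z → evenℤ (z ℤ.- + 1) ≡ not (evenℤ z)
evenℤ-pred z = begin
  evenℤ (z ℤ.- + 1)                   ≡⟨ not-involutive _ ⟨
  not (not (evenℤ (z ℤ.- + 1)))       ≡⟨ cong not (evenℤ-suc (z ℤ.- + 1)) ⟨
  not (evenℤ ((z ℤ.- + 1) ℤ.+ + 1))   ≡⟨ cong (not ∘ evenℤ) (z-1+1≡z z) ⟩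
  not (evenℤ z)                       ∎
  where open ≡-Reasoning

==-sound : ∀ {x y} → x == y ≡ true → x ≡ y
==-sound {x} {y} h = toWitness {a? = x ℤ.≟ y} (subst T (sym h) _)

==-refl : ∀ x → x == x ≡ true
==-refl x = Equivalence.to T-≡ (fromWitness {a? = x ℤ.≟ x} refl)

==-comm : ∀ x y → x == y ≡ y == x
==-comm x y with x ℤ.≟ y | y ℤ.≟ x
... | yes _ | yes _ = refl
... | no _  | no _  = refl
... | yes p | no ¬q = ⊥-elim (¬q (sym p))
... | no ¬p | yes q = ⊥-elim (¬p (sym q))

∨-true : ∀ x {y} → x ∨ y ≡ true → x ≡ true ⊎ y ≡ true
∨-true true  _ = inj₁ refl
∨-true false h = inj₂ h

-- The hexagonal lattice

colour : Point → Bool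
colour (a , b) = evenℤ (a ℤ.+ b)

neighbour : Point → Fin 3 → Point
neighbour (a , b) zero             = (a ℤ.+ + 1 , b)
neighbour (a , b) (suc zero)       = (a ℤ.- + 1 , b)
neighbour (a , b) (suc (suc zero)) = (a , (if evenℤ (a ℤ.+ b) then b ℤ.+ + 1 else b ℤ.- + 1))

neighbour-colour : ∀ p k → colour (neighbour p k) ≡ not (colour p)
neighbour-colour (a , b) zero =
  trans (cong evenℤ (xy∙z≈xz∙y a (+ 1) b)) (evenℤ-suc (a ℤ.+ b))
neighbour-colour (a , b) (suc zero) =
  trans (cong evenℤ (xy∙z≈xz∙y a (ℤ.- + 1) b)) (evenℤ-pred (a ℤ.+ b))
neighbour-colour (a , b) (suc (suc zero)) with evenℤ (a ℤ.+ b) in e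
... | true  = trans (evenℤ-+suc a b) (cong not e)
... | false = trans (cong evenℤ (sym (ℤ.+-assoc a b (ℤ.- + 1)))) (trans (evenℤ-pred (a ℤ.+ b)) (cong not e))

horizontal⇒neighbour : ∀ {a b c} → (c == (a ℤ.+ + 1)) ∨ (a == (c ℤ.+ + 1)) ≡ true →
                       Σ (Fin 3) λ k → (c , b) ≡ neighbour (a , b) k
horizontal⇒neighbour {a} {b} {c} h with ∨-true (c == (a ℤ.+ + 1)) h
... | inj₁ east = zero , cong (_, b) (==-sound east)
... | inj₂ west = suc zero , cong (_, b) (trans (sym (z+1-1≡z c)) (cong (ℤ._- + 1) (sym (==-sound west))))

north-neighbour : ∀ {a b d} → d ≡ b ℤ.+ + 1 → evenℤ (a ℤ.+ b) ≡ true →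
                  d ≡ (if evenℤ (a ℤ.+ b) then b ℤ.+ + 1 else b ℤ.- + 1)
north-neighbour e ev rewrite ev = e

south-neighbour : ∀ {a b d} → b ≡ d ℤ.+ + 1 → evenℤ (a ℤ.+ d) ≡ true →
                  d ≡ (if evenℤ (a ℤ.+ b) then b ℤ.+ + 1 else b ℤ.- + 1)
south-neighbour {a} {d = d} refl ev rewrite evenℤ-+suc a d | ev = sym (z+1-1≡z d)

vertical⇒neighbour : ∀ {a b d} →
  ((d == (b ℤ.+ + 1)) ∧ evenℤ (a ℤ.+ b)) ∨ ((b == (d ℤ.+ + 1)) ∧ evenℤ (a ℤ.+ d)) ≡ true →
  Σ (Fin 3) λ k → (a , d) ≡ neighbour (a , b) k
vertical⇒neighbour {a} {b} {d} h with ∨-true ((d == (b ℤ.+ + 1)) ∧ evenℤ (a ℤ.+ b)) h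
... | inj₁ north = suc (suc zero) , cong (a ,_)
        (north-neighbour {a} {b} (==-sound (∧-conicalˡ _ _ north)) (∧-conicalʳ _ _ north))
... | inj₂ south = suc (suc zero) , cong (a ,_)
        (south-neighbour {a} {b} (==-sound (∧-conicalˡ _ _ south)) (∧-conicalʳ _ _ south))

adjacent⇒neighbour : ∀ p q → Adjacent p q → Σ (Fin 3) λ k → q ≡ neighbour p k
adjacent⇒neighbour (a , b) (c , d) h
  with ∨-true ((b == d) ∧ ((c == (a ℤ.+ + 1)) ∨ (a == (c ℤ.+ + 1)))) h
... | inj₁ horizontal with ==-sound {b} {d} (∧-conicalˡ _ _ horizontal)
...   | refl = horizontal⇒neighbour (∧-conicalʳ _ _ horizontal)
adjacent⇒neighbour (a , b) (c , d) h | inj₂ vertical with ==-sound {a} {c} (∧-conicalˡ _ _ vertical)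
...   | refl = vertical⇒neighbour (∧-conicalʳ _ _ vertical)

adjacent-colour : ∀ p q → Adjacent p q → colour q ≡ not (colour p)
adjacent-colour p q h with adjacent⇒neighbour p q h
... | k , refl = neighbour-colour p k

adjacent-comm : ∀ p q → adjacent p q ≡ adjacent q p
adjacent-comm (a , b) (c , d)
  rewrite ==-comm b d | ==-comm a c
        | ∨-comm (c == (a ℤ.+ + 1)) (a == (c ℤ.+ + 1))
        | ∨-comm ((d == (b ℤ.+ + 1)) ∧ evenℤ (a ℤ.+ b)) ((b == (d ℤ.+ + 1)) ∧ evenℤ (c ℤ.+ d)) = refl

Adjacent-sym : ∀ p q → Adjacent p q → Adjacent q p
Adjacent-sym p q h = trans (sym (adjacent-comm p q)) h

adjacent-east : ∀ a b c → c ≡ a ℤ.+ + 1 → Adjacent (a , b) (c , b)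
adjacent-east a b _ refl rewrite ==-refl b | ==-refl (a ℤ.+ + 1) = refl

at-most-three-neighbours : ∀ p (q : Fin 4 → Point) → (∀ t → Adjacent p (q t)) → ¬ Injective _≡_ _≡_ q
at-most-three-neighbours p q adj q-injective
  with t , u , t<u , same-direction ← pigeonhole (ℕ.n<1+n 3) (λ t → proj₁ (adjacent⇒neighbour p (q t) (adj t)))
  = <⇒≢ t<u (q-injective (begin
      q t           ≡⟨ proj₂ (adjacent⇒neighbour p (q t) (adj t)) ⟩
      neighbour p _ ≡⟨ cong (neighbour p) same-direction ⟩
      neighbour p _ ≡⟨ proj₂ (adjacent⇒neighbour p (q u) (adj u)) ⟨
      q u           ∎))
  where open ≡-Reasoning

-- Folds

predecessor : ∀ {n m} (j : Fin n) → toℕ j ≡ suc m → Σ (Fin n) λ i → toℕ i ≡ m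
predecessor {m = m} j e = fromℕ< m<n , toℕ-fromℕ< m<n
  where m<n = ℕ.<-trans (ℕ.n<1+n m) (subst (ℕ._< _) e (toℕ<n j))

walk-colour : ∀ {w} (f : Fold w) {i j} → toℕ j ≡ suc (toℕ i) → colour (pos f j) ≡ not (colour (pos f i))
walk-colour f {i} {j} e = adjacent-colour (pos f i) (pos f j) (walk f i j e)

colour-even-gap : ∀ {w} (f : Fold w) k {i j} → toℕ j ≡ k * 2 + toℕ i → colour (pos f j) ≡ colour (pos f i)
colour-even-gap f zero    e = cong (colour ∘ pos f) (toℕ-injective e)
colour-even-gap f (suc k) {i} {j} e
  with j₁ , e₁ ← predecessor j e
  with j₂ , e₂ ← predecessor j₁ e₁ = begin
    colour (pos f j)              ≡⟨ walk-colour f (trans e (cong suc (sym e₁))) ⟩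
    not (colour (pos f j₁))       ≡⟨ cong not (walk-colour f (trans e₁ (cong suc (sym e₂)))) ⟩
    not (not (colour (pos f j₂))) ≡⟨ not-involutive _ ⟩
    colour (pos f j₂)             ≡⟨ colour-even-gap f k e₂ ⟩
    colour (pos f i)              ∎
  where open ≡-Reasoning

even-gap-not-adjacent : ∀ {w} (f : Fold w) k {i j} → toℕ j ≡ k * 2 + toℕ i → ¬ Adjacent (pos f i) (pos f j)
even-gap-not-adjacent f k {i} {j} e adj =
  not-¬ (colour-even-gap f k e) (adjacent-colour (pos f i) (pos f j) adj)

pathFold : (P : ℕ → Point) (Q : Point → ℕ) (w : Word) →
           (∀ (i : Fin (length w)) → Q (P (toℕ i)) ≡ toℕ i) → (∀ k → Adjacent (P k) (P (suc k))) → Fold w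
pathFold P Q w Q∘P≗id step = record
  { pos           = P ∘ toℕ
  ; self-avoiding = λ i j e → toℕ-injective (trans (sym (Q∘P≗id i)) (trans (cong Q e) (Q∘P≗id j)))
  ; walk          = λ i j e → subst (λ k → Adjacent (P (toℕ i)) (P k)) (sym e) (step (toℕ i))
  }

embedˡ : ∀ (w v : Word) → Fin (length w) → Fin (length (w ++ v))
embedˡ (_ ∷ w) v zero    = zero
embedˡ (_ ∷ w) v (suc i) = suc (embedˡ w v i)

embedʳ : ∀ (w v : Word) → Fin (length v) → Fin (length (w ++ v))
embedʳ []      v i = i
embedʳ (_ ∷ w) v i = suc (embedʳ w v i)

toℕ-embedˡ : ∀ (w v : Word) i → toℕ (embedˡ w v i) ≡ toℕ i
toℕ-embedˡ (_ ∷ w) v zero    = refl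
toℕ-embedˡ (_ ∷ w) v (suc i) = cong suc (toℕ-embedˡ w v i)

lookup-embedˡ : ∀ (w v : Word) i → lookup (w ++ v) (embedˡ w v i) ≡ lookup w i
lookup-embedˡ (_ ∷ w) v zero    = refl
lookup-embedˡ (_ ∷ w) v (suc i) = lookup-embedˡ w v i

lookup-embedʳ : ∀ (w v : Word) i → lookup (w ++ v) (embedʳ w v i) ≡ lookup v i
lookup-embedʳ []      v i = refl
lookup-embedʳ (_ ∷ w) v i = lookup-embedʳ w v i

prefixFold : ∀ (w v : Word) → Fold (w ++ v) → Fold w
prefixFold w v f = record
  { pos           = pos f ∘ embedˡ w v
  ; self-avoiding = λ i j e → toℕ-injective (begin
      toℕ i              ≡⟨ toℕ-embedˡ w v i ⟨
      toℕ (embedˡ w v i) ≡⟨ cong toℕ (self-avoiding f _ _ e) ⟩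
      toℕ (embedˡ w v j) ≡⟨ toℕ-embedˡ w v j ⟩
      toℕ j              ∎)
  ; walk          = λ i j e → walk f _ _ (begin
      toℕ (embedˡ w v j)       ≡⟨ toℕ-embedˡ w v j ⟩
      toℕ j                    ≡⟨ e ⟩
      suc (toℕ i)              ≡⟨ cong suc (toℕ-embedˡ w v i) ⟨
      suc (toℕ (embedˡ w v i)) ∎)
  }
  where open ≡-Reasoning

-- Scores

sum-tabulate-++ : ∀ (w v : Word) (g : Fin (length (w ++ v)) → ℕ) →
                  sum (tabulate g) ≡ sum (tabulate (g ∘ embedˡ w v)) + sum (tabulate (g ∘ embedʳ w v))
sum-tabulate-++ []      v g = refl
sum-tabulate-++ (_ ∷ w) v g =
  trans (cong (λ s → g zero + s) (sum-tabulate-++ w v (g ∘ suc))) (sym (ℕ.+-assoc (g zero) _ _))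

sum-tabulate-zero : ∀ {n} (g : Fin n → ℕ) → (∀ i → g i ≡ 0) → sum (tabulate g) ≡ 0
sum-tabulate-zero {zero}  g g≡0 = refl
sum-tabulate-zero {suc n} g g≡0 = cong₂ _+_ (g≡0 zero) (sum-tabulate-zero (g ∘ suc) (g≡0 ∘ suc))

score-tabulate : ∀ w (f : Fold w) → score w f ≡ sum (tabulate λ i → sum (tabulate (contact w f i)))
score-tabulate w f =
  cong sum (trans (map-tabulate (λ i → i) _) (tabulate-cong λ i → cong sum (map-tabulate (λ j → j) (contact w f i))))

contact-polarˡ : ∀ w (f : Fold w) i j → lookup w i ≡ 𝟙 → contact w f i j ≡ 0
contact-polarˡ w f i j polar rewrite polar | ∧-zeroʳ (suc (suc (toℕ i)) ≤ᵇ toℕ j) = refl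

contact-polarʳ : ∀ w (f : Fold w) i j → lookup w j ≡ 𝟙 → contact w f i j ≡ 0
contact-polarʳ w f i j polar
  rewrite polar | ∧-zeroʳ (isZero (lookup w i)) | ∧-zeroʳ (suc (suc (toℕ i)) ≤ᵇ toℕ j) = refl

contact-embedˡ : ∀ (w v : Word) (f : Fold (w ++ v)) i j →
                 contact (w ++ v) f (embedˡ w v i) (embedˡ w v j) ≡ contact w (prefixFold w v f) i j
contact-embedˡ w v f i j
  rewrite toℕ-embedˡ w v i | toℕ-embedˡ w v j | lookup-embedˡ w v i | lookup-embedˡ w v j = refl

score-polar-suffix : ∀ (w v : Word) → (∀ i → lookup v i ≡ 𝟙) → (f : Fold (w ++ v)) →
                     score (w ++ v) f ≡ score w (prefixFold w v f)
score-polar-suffix w v polar f = begin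
  score (w ++ v) f
    ≡⟨ score-tabulate (w ++ v) f ⟩
  sum (tabulate row)
    ≡⟨ sum-tabulate-++ w v row ⟩
  sum (tabulate (row ∘ embedˡ w v)) + sum (tabulate (row ∘ embedʳ w v))
    ≡⟨ cong₂ _+_ (cong sum (tabulate-cong prefix-row)) (sum-tabulate-zero _ polar-row) ⟩
  sum (tabulate (λ i → sum (tabulate (contact w f′ i)))) + 0
    ≡⟨ ℕ.+-identityʳ _ ⟩
  sum (tabulate (λ i → sum (tabulate (contact w f′ i))))
    ≡⟨ score-tabulate w f′ ⟨
  score w f′ ∎
  where
  open ≡-Reasoning
  f′ = prefixFold w v f
  row : Fin (length (w ++ v)) → ℕ
  row i = sum (tabulate (contact (w ++ v) f i))
  polar-row : ∀ i → row (embedʳ w v i) ≡ 0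
  polar-row i = sum-tabulate-zero _ λ j →
    contact-polarˡ (w ++ v) f _ j (trans (lookup-embedʳ w v i) (polar i))
  prefix-row : ∀ i → row (embedˡ w v i) ≡ sum (tabulate (contact w f′ i))
  prefix-row i = begin
    row (embedˡ w v i)
      ≡⟨ sum-tabulate-++ w v _ ⟩
    sum (tabulate (contact (w ++ v) f (embedˡ w v i) ∘ embedˡ w v))
      + sum (tabulate (contact (w ++ v) f (embedˡ w v i) ∘ embedʳ w v))
      ≡⟨ cong₂ _+_ (cong sum (tabulate-cong (contact-embedˡ w v f i)))
                   (sum-tabulate-zero _ λ j →
                      contact-polarʳ (w ++ v) f _ _ (trans (lookup-embedʳ w v j) (polar j))) ⟩
    sum (tabulate (contact w f′ i)) + 0
      ≡⟨ ℕ.+-identityʳ _ ⟩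
    sum (tabulate (contact w f′ i)) ∎

indicator : Bool → ℕ
indicator b = if b then 1 else 0

indicator≤1 : ∀ b → indicator b ≤ 1
indicator≤1 true  = s≤s z≤n
indicator≤1 false = z≤n

indicator-+≤1 : ∀ b c → (b ≡ true → c ≡ true → ⊥) → indicator b + indicator c ≤ 1
indicator-+≤1 true  true  both = ⊥-elim (both refl refl)
indicator-+≤1 true  false _    = s≤s z≤n
indicator-+≤1 false c     _    = indicator≤1 c

-- The counterexamples

polar : ℕ → Word
polar m = replicate m 𝟙

lookup-polar : ∀ m i → lookup (polar m) i ≡ 𝟙
lookup-polar (suc m) zero    = refl
lookup-polar (suc m) (suc i) = lookup-polar m i

x : Word
x = 𝟘 ∷ 𝟙 ∷ 𝟙 ∷ 𝟙 ∷ 𝟘 ∷ 𝟙 ∷ 𝟙 ∷ 𝟙 ∷ 𝟙 ∷ 𝟘 ∷ []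

score-x : (g : Fold x) → score x g ≡
  indicator (adjacent (pos g (# 0)) (pos g (# 9))) + indicator (adjacent (pos g (# 4)) (pos g (# 9)))
score-x g with adjacent (pos g (# 0)) (pos g (# 4)) in touch
             | adjacent (pos g (# 0)) (pos g (# 9)) | adjacent (pos g (# 4)) (pos g (# 9))
... | true  | _     | _     = ⊥-elim (even-gap-not-adjacent g 2 refl touch)
... | false | false | false = refl
... | false | false | true  = refl
... | false | true  | false = refl
... | false | true  | true  = refl

score-x≤2 : (g : Fold x) → score x g ≤ 2
score-x≤2 g = ℕ.≤-trans (ℕ.≤-reflexive (score-x g))
  (ℕ.+-mono-≤ (indicator≤1 (adjacent (pos g (# 0)) (pos g (# 9))))
              (indicator≤1 (adjacent (pos g (# 4)) (pos g (# 9)))))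

score-x++polar : ∀ m (f : Fold (x ++ polar m)) → score (x ++ polar m) f ≡
  indicator (adjacent (pos f (# 0)) (pos f (# 9))) + indicator (adjacent (pos f (# 4)) (pos f (# 9)))
score-x++polar m f =
  trans (score-polar-suffix x (polar m) (lookup-polar m) f) (score-x (prefixFold x (polar m) f))

not-both-touch-9 : ∀ m (f : Fold (x ++ polar (suc m))) →
  Adjacent (pos f (# 0)) (pos f (# 9)) → Adjacent (pos f (# 4)) (pos f (# 9)) → ⊥
not-both-touch-9 m f touch₀ touch₄ =
  at-most-three-neighbours (pos f (# 9)) (pos f ∘ around-9) adjacent-to-9
    (λ e → around-9-injective (self-avoiding f _ _ e))
  where
  around-9 : Fin 4 → Fin (length (x ++ polar (suc m)))
  around-9 zero                   = # 0
  around-9 (suc zero)             = # 4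
  around-9 (suc (suc zero))       = # 8
  around-9 (suc (suc (suc zero))) = # 10

  slot : ℕ → Fin 4
  slot 0 = # 0
  slot 4 = # 1
  slot 8 = # 2
  slot _ = # 3

  slot-around-9 : ∀ t → slot (toℕ (around-9 t)) ≡ t
  slot-around-9 zero                   = refl
  slot-around-9 (suc zero)             = refl
  slot-around-9 (suc (suc zero))       = refl
  slot-around-9 (suc (suc (suc zero))) = refl

  around-9-injective : Injective _≡_ _≡_ around-9
  around-9-injective {t} {u} e =
    trans (sym (slot-around-9 t)) (trans (cong (slot ∘ toℕ) e) (slot-around-9 u))

  adjacent-to-9 : ∀ t → Adjacent (pos f (# 9)) (pos f (around-9 t))
  adjacent-to-9 zero                   = Adjacent-sym (pos f (# 0)) _ touch₀
  adjacent-to-9 (suc zero)             = Adjacent-sym (pos f (# 4)) _ touch₄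
  adjacent-to-9 (suc (suc zero))       = Adjacent-sym (pos f (# 8)) _ (walk f (# 8) (# 9) refl)
  adjacent-to-9 (suc (suc (suc zero))) = walk f (# 9) (# 10) refl

score-x++polar≤1 : ∀ m (f : Fold (x ++ polar (suc m))) → score (x ++ polar (suc m)) f ≤ 1
score-x++polar≤1 m f = ℕ.≤-trans (ℕ.≤-reflexive (score-x++polar (suc m) f))
  (indicator-+≤1 (adjacent (pos f (# 0)) (pos f (# 9))) (adjacent (pos f (# 4)) (pos f (# 9)))
                 (not-both-touch-9 m f))

pathXY : ℕ → Point
pathXY 0 = (+ 5 , + 2)
pathXY 1 = (+ 4 , + 2)
pathXY 2 = (+ 3 , + 2)
pathXY 3 = (+ 3 , + 1)
pathXY 4 = (+ 2 , + 1)
pathXY 5 = (+ 1 , + 1)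
pathXY 6 = (+ 0 , + 1)
pathXY 7 = (+ 0 , + 0)
pathXY 8 = (+ 1 , + 0)
pathXY 9 = (+ 2 , + 0)
pathXY (suc (suc (suc (suc (suc (suc (suc (suc (suc (suc m)))))))))) = (+ (3 + m) , + 0)

pathX : ℕ → Point
pathX 0 = (+ 3 , + 0)
pathX 1 = (+ 4 , + 0)
pathX 2 = (+ 4 , + 1)
pathX k = pathXY k

indexXY : Point → ℕ
indexXY (+ n , + 0) = 7 + n
indexXY (+ n , + 1) = 6 ∸ n
indexXY (+ n , + 2) = 5 ∸ n
indexXY _           = 0

indexX : Point → ℕ
indexX (+ 3 , + 0) = 0
indexX (+ 4 , + 0) = 1
indexX (+ 4 , + 1) = 2
indexX p           = indexXY p

stepXY : ∀ k → Adjacent (pathXY k) (pathXY (suc k))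
stepXY 0 = refl
stepXY 1 = refl
stepXY 2 = refl
stepXY 3 = refl
stepXY 4 = refl
stepXY 5 = refl
stepXY 6 = refl
stepXY 7 = refl
stepXY 8 = refl
stepXY 9 = refl
stepXY (suc (suc (suc (suc (suc (suc (suc (suc (suc (suc m)))))))))) =
  adjacent-east (+ (3 + m)) (+ 0) _ (cong +_ (ℕ.+-comm 1 (3 + m)))

stepX : ∀ k → Adjacent (pathX k) (pathX (suc k))
stepX 0                   = refl
stepX 1                   = refl
stepX 2                   = refl
stepX (suc (suc (suc k))) = stepXY (3 + k)

indexXY-pathXY : ∀ k → indexXY (pathXY k) ≡ k
indexXY-pathXY 0 = refl
indexXY-pathXY 1 = refl
indexXY-pathXY 2 = refl
indexXY-pathXY 3 = refl
indexXY-pathXY 4 = refl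
indexXY-pathXY 5 = refl
indexXY-pathXY 6 = refl
indexXY-pathXY 7 = refl
indexXY-pathXY 8 = refl
indexXY-pathXY 9 = refl
indexXY-pathXY (suc (suc (suc (suc (suc (suc (suc (suc (suc (suc m)))))))))) = refl

indexX-pathX : ∀ (i : Fin 10) → indexX (pathX (toℕ i)) ≡ toℕ i
indexX-pathX =
  from-yes (all? {n = 10} {P = λ i → indexX (pathX (toℕ i)) ≡ toℕ i} λ i → indexX (pathX (toℕ i)) ℕ.≟ toℕ i)

foldX : Fold x
foldX = pathFold pathX indexX x indexX-pathX stepX

foldXY : ∀ m → Fold (x ++ polar m)
foldXY m = pathFold pathXY indexXY (x ++ polar m) (indexXY-pathXY ∘ toℕ) stepXY

Jhex-x : IsJhex x 2
Jhex-x = (foldX , score-x foldX) , score-x≤2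

Jhex-x++polar : ∀ m → IsJhex (x ++ polar (suc m)) 1
Jhex-x++polar m = (foldXY (suc m) , score-x++polar (suc m) (foldXY (suc m))) , score-x++polar≤1 m

corollary2p10 : (N : ℕ) → Σ Word (λ x → Σ Word (λ y → N ≤ length x + length y
                  × Σ ℕ (λ a → Σ ℕ (λ b → IsJhex (x ++ y) a × IsJhex x b × a < b))))
corollary2p10 N = x , polar (suc N) , long-enough , 1 , 2 , Jhex-x++polar N , Jhex-x , s≤s (s≤s z≤n)
  where
  long-enough : N ≤ length x + length (polar (suc N))
  long-enough rewrite length-replicate (suc N) {𝟙} = ℕ.≤-trans (ℕ.n≤1+n N) (ℕ.m≤n+m (suc N) 10)
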